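{- Let $q$ be an odd prime power, let $\sigma$ be a permutation of $\mathbb{F}_q$ whose graph contains exactly $(q-1)/2$ collinear triples, and let $\Omega=\{[x:\sigma(x):1]:x\in\mathbb{F}_q\}\cup\{[1:0:0],[0:1:0]\}\subseteq PG(2,q)$. Write $\Omega=C\cup\{P\}$ with $C$ the point set of an irreducible conic in $PG(2,q)$ and $P\notin C$ the external point, and let $\Gamma'=\{(x,y)\in\mathbb{F}_q^2:[x:y:1]\in C\}$. Then $\Gamma'$ is the graph of a fractional linear transformation: there are $c,d,e,f\in\mathbb{F}_q$ such that $\Gamma'=\{(x,y): cx+e\neq 0,\ y=(dx+f)/(cx+e)\}$.
   Context: A collinear triple in a permutation $\sigma$ of $\mathbb{F}_q$ is a set of three distinct points of its graph lying on a common line of the affine plane $\mathbb{F}_q^2$. It is known (and assumed here) that such an $\Omega$ is the union of the points of an irreducible conic and one external point not on it. -}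

module Defs where

open import Level using (0ℓ)
open import Data.Nat using (ℕ; suc; _^_; _∸_; _/_)
open import Data.Nat.Primality using (Prime)
open import Data.Nat.Divisibility using (_∣_)
open import Data.Fin as Fin using (Fin)
open import Data.Product using (Σ; ∃; _×_; _,_)
open import Data.Sum using (_⊎_)
open import Data.List using (List; length)
open import Data.List.Membership.Propositional using (_∈_)
open import Data.List.Relation.Unary.Unique.Propositional using (Unique)
open import Relation.Nullary using (¬_)
open import Relation.Binary.PropositionalEquality using (_≡_; _≢_)
open import Algebra.Structures using (IsCommutativeRing)
open import Function.Bundles using (_⤖_; _⇔_; Bijection)
open import Function.Definitions using (Bijective)

record Field : Set₁ where
  infixl 6 _+_
  infixl 7 _*_
  field
    Carrier : Set
    _+_ _*_ : Carrier → Carrier → Carrier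
    -_ : Carrier → Carrier
    0# 1# : Carrier
    isCommutativeRing : IsCommutativeRing _≡_ _+_ _*_ -_ 0# 1#
    _⁻¹ : Carrier → Carrier
    ⁻¹-inverse : ∀ x → x ≢ 0# → x * (x ⁻¹) ≡ 1#
    0≢1 : 0# ≢ 1#

OddPrimePower : ℕ → Set
OddPrimePower q = (Σ ℕ λ p → Σ ℕ λ k → Prime p × q ≡ p ^ suc k) × ¬ (2 ∣ q)

module _ (F : Field) where
  open Field F

  HasSize : ℕ → Set
  HasSize q = Fin q ⤖ Carrier

  IsPermutation : (Carrier → Carrier) → Set
  IsPermutation σ = Bijective _≡_ _≡_ σ

  OnAffineLine : Carrier × Carrier × Carrier → Carrier × Carrier → Set
  OnAffineLine (l₁ , l₂ , l₃) (x , y) = l₁ * x + l₂ * y + l₃ ≡ 0#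

  IsAffineLine : Carrier × Carrier × Carrier → Set
  IsAffineLine (l₁ , l₂ , l₃) = ¬ (l₁ ≡ 0# × l₂ ≡ 0#)

  Collinear : (Carrier × Carrier) → (Carrier × Carrier) → (Carrier × Carrier) → Set
  Collinear a b c = Σ (Carrier × Carrier × Carrier) λ l →
    IsAffineLine l × OnAffineLine l a × OnAffineLine l b × OnAffineLine l c

  -- Triples (3-subsets of the
  -- graph) are indexed by i < j < k in Fin q via the enumeration of F; the list
  -- L lists (without repetition) exactly the collinear ones.
  ExactlyNCollinearTriples : (q : ℕ) → HasSize q → (Carrier → Carrier) → ℕ → Set
  ExactlyNCollinearTriples q enum σ N =
    Σ (List (Fin q × Fin q × Fin q)) λ L →
      Unique L × length L ≡ N ×
      (∀ i j k → ((i , j , k) ∈ L) ⇔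
        (i Fin.< j × j Fin.< k × Collinear (pt i) (pt j) (pt k)))
    where
      pt : Fin q → Carrier × Carrier
      pt i = Bijection.to enum i , σ (Bijection.to enum i)

  -- Homogeneous coordinates of PG(2,q)
  Triple : Set
  Triple = Carrier × Carrier × Carrier

  NonZeroTriple : Triple → Set
  NonZeroTriple (x , y , z) = ¬ (x ≡ 0# × y ≡ 0# × z ≡ 0#)

  _∼_ : Triple → Triple → Set
  (x , y , z) ∼ (x' , y' , z') =
    Σ Carrier λ λ' → λ' ≢ 0# × x ≡ λ' * x' × y ≡ λ' * y' × z ≡ λ' * z'

  InΩ : (Carrier → Carrier) → Triple → Set
  InΩ σ v = (Σ Carrier λ x → v ∼ (x , σ x , 1#)) ⊎ v ∼ (1# , 0# , 0#) ⊎ v ∼ (0# , 1# , 0#)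

  QForm : Set
  QForm = Carrier × Carrier × Carrier × Carrier × Carrier × Carrier

  evalQ : QForm → Triple → Carrier
  evalQ (a , b , c , d , e , f) (X , Y , Z) =
    a * X * X + b * Y * Y + c * Z * Z + d * X * Y + e * X * Z + f * Y * Z

  -- coefficient vector of the product of two linear forms
  linProd : Triple → Triple → QForm
  linProd (l₁ , l₂ , l₃) (m₁ , m₂ , m₃) =
    l₁ * m₁ , l₂ * m₂ , l₃ * m₃ , l₁ * m₂ + l₂ * m₁ , l₁ * m₃ + l₃ * m₁ , l₂ * m₃ + l₃ * m₂

  Irreducible : QForm → Set
  Irreducible Q = Q ≢ (0# , 0# , 0# , 0# , 0# , 0#) × (∀ l m → Q ≢ linProd l m)

  OnConic : QForm → Triple → Set
  OnConic Q v = evalQ Q v ≡ 0#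

-- Since q is odd, 2 ≠ 0 in F: otherwise x ↦ x + 1 would be a fixed-point-free involution of a
-- set of odd size. Write Q = aX² + bY² + cZ² + dXY + eXZ + fYZ. The points [1:0:0] and [0:1:0]
-- belong to Ω, so each lies on C or is P.
-- If both lie on C then a = b = 0, and on the affine chart Q = 0 reads y(dx + f) + (ex + c) = 0,
-- that is y = -(ex + c)/(dx + f); here dx + f cannot vanish on C, since then the line X = xZ
-- would be a component of C.
-- If P = [0:1:0], then b ≠ 0 and the affine points of C are exactly the graph of σ, so for every x
-- the quadratic by² + (dx + f)y + (ax² + ex + c) in y has a single root. Its discriminant then
-- vanishes identically in x, which makes 4b·Q the square of dX + 2bY + fZ, contradicting
-- irreducibility. The case P = [1:0:0] is the same with X and Y exchanged, since σ is a bijection.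
module Submission where

open import Defs
open import Data.Nat using (ℕ; _∸_; _/_)
open import Data.Product using (Σ; _×_; _,_)
open import Data.Sum using (_⊎_)
open import Relation.Nullary using (¬_)
open import Relation.Binary.PropositionalEquality using (_≡_; _≢_)
open import Function.Bundles using (_⇔_)

open import Level using (0ℓ)
open import Data.Nat as ℕ using (zero; suc)
open import Data.Nat.Properties using (+-suc; suc-injective)
open import Data.Nat.Divisibility using (_∣_; _∣0; ∣-refl; ∣m∣n⇒∣m+n)
open import Data.Integer as ℤ using (ℤ; -[1+_]; _⊖_)
open import Data.Integer.Properties using ([1+m]⊖[1+n]≡m⊖n)
open import Data.Sign as Sign using (Sign)
open import Data.Fin as Fin using (Fin)
open import Data.Maybe using (Maybe; just; nothing)
open import Data.Empty using (⊥-elim)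
open import Data.Product using (proj₂)
open import Data.Sum using (inj₁; inj₂)
open import Data.List using (List; []; _∷_; length; filter)
open import Data.List.Properties using (filter-all; filter-accept; filter-reject; length-tabulate)
open import Data.List.Membership.Propositional using (_∈_)
open import Data.List.Membership.Propositional.Properties using (∈-filter⁺; ∈-filter⁻; ∈-allFin)
open import Data.List.Relation.Unary.Any using (here; there)
import Data.List.Relation.Unary.All as All
open import Data.List.Relation.Unary.AllPairs using (_∷_)
open import Data.List.Relation.Unary.Unique.Propositional using (Unique)
open import Data.List.Relation.Unary.Unique.Propositional.Properties using (filter⁺; allFin⁺)
open import Function.Base using (id)
open import Function.Bundles using (_⤖_; Inverse; mk⤖; mk⇔; module Equivalence)
open import Function.Properties.Bijection using (⤖⇒↔)
open import Relation.Nullary using (Dec; yes; no; ¬?)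
open import Relation.Binary.Definitions using (DecidableEquality)
open import Relation.Binary.PropositionalEquality
  using (refl; sym; trans; cong; cong₂; subst; subst₂; ≢-sym; module ≡-Reasoning)
open import Algebra.Bundles using (CommutativeRing)
open import Algebra.Solver.Ring.AlmostCommutativeRing
  using (fromCommutativeRing; _-Raw-AlmostCommutative⟶_)

module FixedPointFreeInvolution {A : Set} (_≟_ : DecidableEquality A) {g : A → A}
  (g-involutive : ∀ x → g (g x) ≡ x) (g-fixedPointFree : ∀ x → g x ≢ x) where

  open ≡-Reasoning

  private
    ≢? : (y z : A) → Dec (z ≢ y)
    ≢? y z = ¬? (z ≟ y)

    length-filter≢ : ∀ {y xs} → Unique xs → y ∈ xs → length xs ≡ suc (length (filter (≢? y) xs))
    length-filter≢ {xs = y ∷ xs} (y∉xs ∷ _) (here refl) = cong suc (cong length (sym (begin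
      filter (≢? y) (y ∷ xs)  ≡⟨ filter-reject (≢? y) (λ y≢y → y≢y refl) ⟩
      filter (≢? y) xs        ≡⟨ filter-all (≢? y) (All.map ≢-sym y∉xs) ⟩
      xs                      ∎)))
    length-filter≢ {y} {x ∷ xs} (x∉xs ∷ unique) (there y∈xs) = trans
      (cong suc (length-filter≢ unique y∈xs))
      (cong (λ ys → suc (length ys)) (sym (filter-accept (≢? y) (All.lookup x∉xs y∈xs))))

  closed⇒even : ∀ n {xs} → length xs ≡ n → Unique xs → (∀ {x} → x ∈ xs → g x ∈ xs) → 2 ∣ n
  closed⇒even zero          _ _ _ = 2 ∣0
  closed⇒even (suc zero)    {x ∷ []} _ _ closed with closed (here refl)
  ... | here gx≡x = ⊥-elim (g-fixedPointFree x gx≡x)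
  closed⇒even (suc (suc n)) {x ∷ xs} |xs|≡1+n (x∉xs ∷ unique) closed =
    ∣m∣n⇒∣m+n (∣-refl {2}) (closed⇒even n |xs′|≡n (filter⁺ (≢? (g x)) unique) closed′)
    where
    xs′ : List A
    xs′ = filter (≢? (g x)) xs
    gx∈xs : g x ∈ xs
    gx∈xs with closed (here refl)
    ... | here gx≡x   = ⊥-elim (g-fixedPointFree x gx≡x)
    ... | there gx∈xs = gx∈xs
    |xs′|≡n : length xs′ ≡ n
    |xs′|≡n = suc-injective (trans (sym (length-filter≢ unique gx∈xs)) (suc-injective |xs|≡1+n))
    closed′ : ∀ {y} → y ∈ xs′ → g y ∈ xs′
    closed′ {y} y∈xs′ with ∈-filter⁻ (≢? (g x)) y∈xs′
    ... | y∈xs , y≢gx with closed (there y∈xs)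
    ...   | here gy≡x    = ⊥-elim (y≢gx (trans (sym (g-involutive y)) (cong g gy≡x)))
    ...   | there gy∈xs  = ∈-filter⁺ (≢? (g x)) gy∈xs (λ gy≡gx → All.lookup x∉xs y∈xs (begin
      x          ≡⟨ sym (g-involutive x) ⟩
      g (g x)    ≡⟨ cong g (sym gy≡gx) ⟩
      g (g y)    ≡⟨ g-involutive y ⟩
      y          ∎))

fixedPointFreeInvolution⇒even : ∀ {A : Set} {n} → Fin n ⤖ A → (g : A → A) →
  (∀ x → g (g x) ≡ x) → (∀ x → g x ≢ x) → 2 ∣ n
fixedPointFreeInvolution⇒even {n = n} enum g g-involutive g-fixedPointFree =
  closed⇒even n (length-tabulate id) (allFin⁺ n) (λ {i} _ → ∈-allFin (h i))
  where
  open Inverse (⤖⇒↔ enum)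
  open ≡-Reasoning
  h : Fin n → Fin n
  h i = from (g (to i))
  h-involutive : ∀ i → h (h i) ≡ i
  h-involutive i = begin
    from (g (to (from (g (to i)))))  ≡⟨ cong (λ x → from (g x)) (strictlyInverseˡ (g (to i))) ⟩
    from (g (g (to i)))              ≡⟨ cong from (g-involutive (to i)) ⟩
    from (to i)                      ≡⟨ strictlyInverseʳ i ⟩
    i                                ∎
  h-fixedPointFree : ∀ i → h i ≢ i
  h-fixedPointFree i hi≡i = g-fixedPointFree (to i) (trans (sym (strictlyInverseˡ (g (to i)))) (cong to hi≡i))
  open FixedPointFreeInvolution Fin._≟_ h-involutive h-fixedPointFree

-- Normalising a ring expression has to compute with its coefficients, which the abstract
-- operations of F cannot do, so the solver runs with integer coefficients mapped into F.
module IntegerCoefficients (F : Field) where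
  open Field F

  commutativeRing : CommutativeRing 0ℓ 0ℓ
  commutativeRing = record { isCommutativeRing = isCommutativeRing }

  private
    open CommutativeRing commutativeRing
      using (_-_; +-comm; +-assoc; +-identityˡ; +-identityʳ; -‿inverseʳ; ring; semiring)
    open import Algebra.Properties.Ring ring
      using (-‿distribˡ-*; -‿distribʳ-*; -‿involutive; -0#≈0#; -‿+-comm)
    open import Algebra.Properties.Semiring.Mult.TCOptimised semiring
      using (1+×; ×-homo-+; ×1-homo-*) renaming (_×_ to _×′_)
    open ≡-Reasoning

    ℤ→F : ℤ → Carrier
    ℤ→F (ℤ.+ n)  = n ×′ 1#
    ℤ→F -[1+ n ] = - (suc n ×′ 1#)

    1+x-1+y≡x-y : ∀ x y → (1# + x) - (1# + y) ≡ x - y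
    1+x-1+y≡x-y x y = begin
      (1# + x) + - (1# + y)        ≡⟨ cong₂ _+_ (+-comm 1# x) (sym (-‿+-comm 1# y)) ⟩
      (x + 1#) + (- 1# + - y)      ≡⟨ +-assoc x 1# _ ⟩
      x + (1# + (- 1# + - y))      ≡⟨ cong (x +_) (sym (+-assoc 1# (- 1#) (- y))) ⟩
      x + ((1# + - 1#) + - y)      ≡⟨ cong (λ z → x + (z + - y)) (-‿inverseʳ 1#) ⟩
      x + (0# + - y)               ≡⟨ cong (x +_) (+-identityˡ (- y)) ⟩
      x + - y                      ∎

    ⊖-homo : ∀ m n → ℤ→F (m ⊖ n) ≡ m ×′ 1# - n ×′ 1#
    ⊖-homo zero    zero    = sym (-‿inverseʳ 0#)
    ⊖-homo (suc m) zero    = begin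
      suc m ×′ 1#             ≡⟨ sym (+-identityʳ _) ⟩
      suc m ×′ 1# + 0#        ≡⟨ cong ((suc m ×′ 1#) +_) (sym -0#≈0#) ⟩
      suc m ×′ 1# - 0#        ∎
    ⊖-homo zero    (suc n) = sym (+-identityˡ _)
    ⊖-homo (suc m) (suc n) = begin
      ℤ→F (suc m ⊖ suc n)                ≡⟨ cong ℤ→F ([1+m]⊖[1+n]≡m⊖n m n) ⟩
      ℤ→F (m ⊖ n)                        ≡⟨ ⊖-homo m n ⟩
      m ×′ 1# - n ×′ 1#                  ≡⟨ sym (1+x-1+y≡x-y (m ×′ 1#) (n ×′ 1#)) ⟩
      (1# + m ×′ 1#) - (1# + n ×′ 1#)    ≡⟨ sym (cong₂ _-_ (1+× m 1#) (1+× n 1#)) ⟩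
      suc m ×′ 1# - suc n ×′ 1#          ∎

    +-homo : ∀ i j → ℤ→F (i ℤ.+ j) ≡ ℤ→F i + ℤ→F j
    +-homo (ℤ.+ m)  (ℤ.+ n)  = ×-homo-+ 1# m n
    +-homo (ℤ.+ m)  -[1+ n ] = ⊖-homo m (suc n)
    +-homo -[1+ m ] (ℤ.+ n)  = trans (⊖-homo n (suc m)) (+-comm _ _)
    +-homo -[1+ m ] -[1+ n ] = begin
      - (suc (suc (m ℕ.+ n)) ×′ 1#)        ≡⟨ cong (λ k → - (suc k ×′ 1#)) (sym (+-suc m n)) ⟩
      - ((suc m ℕ.+ suc n) ×′ 1#)          ≡⟨ cong -_ (×-homo-+ 1# (suc m) (suc n)) ⟩
      - (suc m ×′ 1# + suc n ×′ 1#)        ≡⟨ sym (-‿+-comm _ _) ⟩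
      - (suc m ×′ 1#) + - (suc n ×′ 1#)    ∎

    -‿homo : ∀ i → ℤ→F (ℤ.- i) ≡ - ℤ→F i
    -‿homo (ℤ.+ zero)  = sym -0#≈0#
    -‿homo (ℤ.+ suc n) = refl
    -‿homo -[1+ n ]    = sym (-‿involutive _)

    signed : Sign → Carrier → Carrier
    signed Sign.+ x = x
    signed Sign.- x = - x

    ◃-homo : ∀ s n → ℤ→F (s ℤ.◃ n) ≡ signed s (n ×′ 1#)
    ◃-homo Sign.+ zero    = refl
    ◃-homo Sign.- zero    = sym -0#≈0#
    ◃-homo Sign.+ (suc n) = refl
    ◃-homo Sign.- (suc n) = refl

    ℤ→F-signAbs : ∀ i → ℤ→F i ≡ signed (ℤ.sign i) (ℤ.∣ i ∣ ×′ 1#)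
    ℤ→F-signAbs (ℤ.+ zero)  = refl
    ℤ→F-signAbs (ℤ.+ suc n) = refl
    ℤ→F-signAbs -[1+ n ]    = refl

    signed-* : ∀ s t x y → signed (s Sign.* t) (x * y) ≡ signed s x * signed t y
    signed-* Sign.+ Sign.+ x y = refl
    signed-* Sign.+ Sign.- x y = -‿distribʳ-* x y
    signed-* Sign.- Sign.+ x y = -‿distribˡ-* x y
    signed-* Sign.- Sign.- x y = begin
      x * y         ≡⟨ sym (-‿involutive _) ⟩
      - - (x * y)   ≡⟨ cong -_ (-‿distribˡ-* x y) ⟩
      - (- x * y)   ≡⟨ -‿distribʳ-* (- x) y ⟩
      - x * - y     ∎

    *-homo : ∀ i j → ℤ→F (i ℤ.* j) ≡ ℤ→F i * ℤ→F j
    *-homo i j = begin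
      ℤ→F (i ℤ.* j)                                   ≡⟨ ◃-homo (s Sign.* t) (ℤ.∣ i ∣ ℕ.* ℤ.∣ j ∣) ⟩
      signed (s Sign.* t) ((ℤ.∣ i ∣ ℕ.* ℤ.∣ j ∣) ×′ 1#) ≡⟨ cong (signed (s Sign.* t)) (×1-homo-* ℤ.∣ i ∣ ℤ.∣ j ∣) ⟩
      signed (s Sign.* t) (∣i∣ * ∣j∣)                  ≡⟨ signed-* s t ∣i∣ ∣j∣ ⟩
      signed s ∣i∣ * signed t ∣j∣                      ≡⟨ sym (cong₂ _*_ (ℤ→F-signAbs i) (ℤ→F-signAbs j)) ⟩
      ℤ→F i * ℤ→F j                                   ∎
      where
      s t : Sign
      s = ℤ.sign i
      t = ℤ.sign j
      ∣i∣ ∣j∣ : Carrier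
      ∣i∣ = ℤ.∣ i ∣ ×′ 1#
      ∣j∣ = ℤ.∣ j ∣ ×′ 1#

    ℤ→F-homomorphism : ℤ.+-*-rawRing -Raw-AlmostCommutative⟶ fromCommutativeRing commutativeRing
    ℤ→F-homomorphism = record
      { ⟦_⟧ = ℤ→F ; +-homo = +-homo ; *-homo = *-homo ; -‿homo = -‿homo ; 0-homo = refl ; 1-homo = refl }

    ℤ→F-≟ : ∀ i j → Maybe (ℤ→F i ≡ ℤ→F j)
    ℤ→F-≟ i j with i ℤ.≟ j
    ... | yes i≡j = just (cong ℤ→F i≡j)
    ... | no _    = nothing

  open import Algebra.Solver.Ring ℤ.+-*-rawRing (fromCommutativeRing commutativeRing) ℤ→F-homomorphism ℤ→F-≟ public

  κ : ∀ {n} → ℕ → Polynomial n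
  κ k = con (ℤ.+ k)

module FieldProperties (F : Field) where
  open Field F
  open IntegerCoefficients F
  open CommutativeRing commutativeRing using (ring; +-assoc; +-identityʳ; *-identityˡ; zeroʳ)
  open import Algebra.Properties.Ring ring using (+-cancelˡ; +-cancelʳ)
  open ≡-Reasoning

  two : Carrier
  two = 1# + 1#

  1≢0 : 1# ≢ 0#
  1≢0 1≡0 = 0≢1 (sym 1≡0)

  ⁻¹-cancelˡ : ∀ {x} → x ≢ 0# → ∀ y → x ⁻¹ * (x * y) ≡ y
  ⁻¹-cancelˡ {x} x≢0 y = begin
    x ⁻¹ * (x * y)  ≡⟨ solve 3 (λ x x⁻¹ y → x⁻¹ :* (x :* y) := (x :* x⁻¹) :* y) refl x (x ⁻¹) y ⟩
    (x * x ⁻¹) * y  ≡⟨ cong (_* y) (⁻¹-inverse x x≢0) ⟩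
    1# * y          ≡⟨ *-identityˡ y ⟩
    y               ∎

  *-cancelˡ : ∀ {x y z} → x ≢ 0# → x * y ≡ x * z → y ≡ z
  *-cancelˡ {x} {y} {z} x≢0 xy≡xz = begin
    y               ≡⟨ sym (⁻¹-cancelˡ x≢0 y) ⟩
    x ⁻¹ * (x * y)  ≡⟨ cong (x ⁻¹ *_) xy≡xz ⟩
    x ⁻¹ * (x * z)  ≡⟨ ⁻¹-cancelˡ x≢0 z ⟩
    z               ∎

  x*y≡0⇒y≡0 : ∀ {x y} → x ≢ 0# → x * y ≡ 0# → y ≡ 0#
  x*y≡0⇒y≡0 {x} x≢0 xy≡0 = *-cancelˡ x≢0 (trans xy≡0 (sym (zeroʳ x)))

  x≢0∧y≢0⇒x*y≢0 : ∀ {x y} → x ≢ 0# → y ≢ 0# → x * y ≢ 0#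
  x≢0∧y≢0⇒x*y≢0 x≢0 y≢0 xy≡0 = y≢0 (x*y≡0⇒y≡0 x≢0 xy≡0)

  x*y≡z⇔x≡z*y⁻¹ : ∀ {x y z} → y ≢ 0# → (x * y ≡ z) ⇔ (x ≡ z * y ⁻¹)
  x*y≡z⇔x≡z*y⁻¹ {x} {y} {z} y≢0 = mk⇔ to from
    where
    to : x * y ≡ z → x ≡ z * y ⁻¹
    to xy≡z = begin
      x               ≡⟨ sym (⁻¹-cancelˡ y≢0 x) ⟩
      y ⁻¹ * (y * x)  ≡⟨ solve 3 (λ x y y⁻¹ → y⁻¹ :* (y :* x) := (x :* y) :* y⁻¹) refl x y (y ⁻¹) ⟩
      (x * y) * y ⁻¹  ≡⟨ cong (_* y ⁻¹) xy≡z ⟩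
      z * y ⁻¹        ∎
    from : x ≡ z * y ⁻¹ → x * y ≡ z
    from x≡z/y = begin
      x * y               ≡⟨ cong (_* y) x≡z/y ⟩
      z * y ⁻¹ * y        ≡⟨ solve 3 (λ y y⁻¹ z → z :* y⁻¹ :* y := z :* (y :* y⁻¹)) refl y (y ⁻¹) z ⟩
      z * (y * y ⁻¹)      ≡⟨ cong (z *_) (⁻¹-inverse y y≢0) ⟩
      z * 1#              ≡⟨ solve 1 (λ z → z :* κ 1 := z) refl z ⟩
      z                   ∎

  quadratic : Carrier → Carrier → Carrier → Carrier → Carrier
  quadratic α β γ x = α * x * x + β * x + γ

  quadratic-injective : ∀ {α β γ α′ β′ γ′} → two ≢ 0# →
    (∀ x → quadratic α β γ x ≡ quadratic α′ β′ γ′ x) → α ≡ α′ × β ≡ β′ × γ ≡ γ′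
  quadratic-injective {α} {β} {γ} {α′} {β′} {γ′} 2≢0 agree = α≡α′ , β≡β′ , γ≡γ′
    where
    at0 : ∀ α β γ → quadratic α β γ 0# ≡ γ
    at0 = solve 3 (λ α β γ → α :* κ 0 :* κ 0 :+ β :* κ 0 :+ γ := γ) refl
    at1 : ∀ α β γ → quadratic α β γ 1# ≡ β + (α + γ)
    at1 = solve 3 (λ α β γ → α :* κ 1 :* κ 1 :+ β :* κ 1 :+ γ := β :+ (α :+ γ)) refl
    at±1 : ∀ α β γ → quadratic α β γ 1# + quadratic α β γ (- 1#) ≡ two * (α + γ)
    at±1 = solve 3 (λ α β γ →
      (α :* κ 1 :* κ 1 :+ β :* κ 1 :+ γ)
        :+ (α :* :- κ 1 :* :- κ 1 :+ β :* :- κ 1 :+ γ)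
      := κ 2 :* (α :+ γ)) refl
    γ≡γ′ : γ ≡ γ′
    γ≡γ′ = trans (sym (at0 α β γ)) (trans (agree 0#) (at0 α′ β′ γ′))
    α+γ≡α′+γ′ : α + γ ≡ α′ + γ′
    α+γ≡α′+γ′ = *-cancelˡ 2≢0 (begin
      two * (α + γ)                                           ≡⟨ sym (at±1 α β γ) ⟩
      quadratic α β γ 1# + quadratic α β γ (- 1#)             ≡⟨ cong₂ _+_ (agree 1#) (agree (- 1#)) ⟩
      quadratic α′ β′ γ′ 1# + quadratic α′ β′ γ′ (- 1#)       ≡⟨ at±1 α′ β′ γ′ ⟩
      two * (α′ + γ′)                                         ∎)
    α≡α′ : α ≡ α′
    α≡α′ = +-cancelʳ γ α α′ (trans α+γ≡α′+γ′ (cong (α′ +_) (sym γ≡γ′)))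
    β≡β′ : β ≡ β′
    β≡β′ = +-cancelʳ (α + γ) β β′
      (trans (sym (at1 α β γ)) (trans (agree 1#) (trans (at1 α′ β′ γ′) (cong (β′ +_) (sym α+γ≡α′+γ′)))))

  uniqueRoot⇒doubleRoot : ∀ {b B C y₀} → b ≢ 0# → quadratic b B C y₀ ≡ 0# →
    (∀ y → quadratic b B C y ≡ 0# → y ≡ y₀) → two * b * y₀ + B ≡ 0#
  uniqueRoot⇒doubleRoot {b} {B} {C} {y₀} b≢0 root unique = begin
    two * b * y₀ + B                          ≡⟨ split b B y₀ b⁻¹ ⟩
    b * (y₀ + - y₁) + B * (1# + - (b * b⁻¹))  ≡⟨ cong₂ (λ y u → b * (y₀ + - y) + B * (1# + - u)) y₁≡y₀ bb⁻¹≡1 ⟩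
    b * (y₀ + - y₀) + B * (1# + - 1#)         ≡⟨ cancel b B y₀ ⟩
    0#                                        ∎
    where
    b⁻¹ : Carrier
    b⁻¹ = b ⁻¹
    bb⁻¹≡1 : b * b⁻¹ ≡ 1#
    bb⁻¹≡1 = ⁻¹-inverse b b≢0
    -- the other root, by Vieta: y₀ + y₁ = - B / b
    y₁ : Carrier
    y₁ = - (B * b⁻¹) + - y₀
    y₁-root : quadratic b B C y₁ ≡ 0#
    y₁-root = begin
      quadratic b B C y₁                           ≡⟨ vieta b B C y₀ b⁻¹ ⟩
      quadratic b B C y₀ + (b * b⁻¹ + - 1#) * w    ≡⟨ cong₂ (λ r u → r + (u + - 1#) * w) root bb⁻¹≡1 ⟩
      0# + (1# + - 1#) * w                         ≡⟨ solve 1 (λ w → κ 0 :+ (κ 1 :+ :- κ 1) :* w := κ 0) refl w ⟩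
      0#                                           ∎
      where
      w : Carrier
      w = B * B * b⁻¹ + two * B * y₀
      vieta : ∀ b B C y₀ b⁻¹ → quadratic b B C (- (B * b⁻¹) + - y₀) ≡
        quadratic b B C y₀ + (b * b⁻¹ + - 1#) * (B * B * b⁻¹ + two * B * y₀)
      vieta = solve 5 (λ b B C y₀ b⁻¹ →
        b :* (:- (B :* b⁻¹) :+ :- y₀) :* (:- (B :* b⁻¹) :+ :- y₀) :+ B :* (:- (B :* b⁻¹) :+ :- y₀) :+ C
        := (b :* y₀ :* y₀ :+ B :* y₀ :+ C) :+ (b :* b⁻¹ :+ :- κ 1) :* (B :* B :* b⁻¹ :+ κ 2 :* B :* y₀)) refl
    y₁≡y₀ : y₁ ≡ y₀
    y₁≡y₀ = unique y₁ y₁-root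
    split : ∀ b B y₀ b⁻¹ → two * b * y₀ + B ≡ b * (y₀ + - (- (B * b⁻¹) + - y₀)) + B * (1# + - (b * b⁻¹))
    split = solve 4 (λ b B y₀ b⁻¹ → κ 2 :* b :* y₀ :+ B
      := b :* (y₀ :+ :- (:- (B :* b⁻¹) :+ :- y₀)) :+ B :* (κ 1 :+ :- (b :* b⁻¹))) refl
    cancel : ∀ b B y₀ → b * (y₀ + - y₀) + B * (1# + - 1#) ≡ 0#
    cancel = solve 3 (λ b B y₀ → b :* (y₀ :+ :- y₀) :+ B :* (κ 1 :+ :- κ 1) := κ 0) refl

  doubleRoot⇒discriminant≡0 : ∀ {b B C y₀} → quadratic b B C y₀ ≡ 0# → two * b * y₀ + B ≡ 0# →
    B * B ≡ two * two * b * C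
  doubleRoot⇒discriminant≡0 {b} {B} {C} {y₀} root double = begin
    B * B                                       ≡⟨ solve 3 (λ b B C →
                                                     B :* B := B :* B :+ κ 2 :* κ 2 :* b :* κ 0) refl b B C ⟩
    B * B + two * two * b * 0#                  ≡⟨ cong (λ r → B * B + two * two * b * r) (sym root) ⟩
    B * B + two * two * b * quadratic b B C y₀  ≡⟨ complete b B C y₀ ⟩
    s * s + two * two * b * C                   ≡⟨ cong (λ u → u * u + two * two * b * C) double ⟩
    0# * 0# + two * two * b * C                 ≡⟨ solve 2 (λ b C →
                                                     κ 0 :* κ 0 :+ κ 2 :* κ 2 :* b :* C := κ 2 :* κ 2 :* b :* C) refl b C ⟩
    two * two * b * C                           ∎
    where
    s : Carrier
    s = two * b * y₀ + B
    complete : ∀ b B C y₀ → B * B + two * two * b * quadratic b B C y₀ ≡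
      (two * b * y₀ + B) * (two * b * y₀ + B) + two * two * b * C
    complete = solve 4 (λ b B C y₀ →
      B :* B :+ κ 2 :* κ 2 :* b :* (b :* y₀ :* y₀ :+ B :* y₀ :+ C)
      := (κ 2 :* b :* y₀ :+ B) :* (κ 2 :* b :* y₀ :+ B) :+ κ 2 :* κ 2 :* b :* C) refl

  oddSize⇒2≢0 : ∀ {q} → HasSize F q → ¬ 2 ∣ q → two ≢ 0#
  oddSize⇒2≢0 enum 2∤q 2≡0 =
    2∤q (fixedPointFreeInvolution⇒even enum (_+ 1#) +1-involutive +1-fixedPointFree)
    where
    +1-involutive : ∀ x → x + 1# + 1# ≡ x
    +1-involutive x = begin
      x + 1# + 1#   ≡⟨ +-assoc x 1# 1# ⟩
      x + two       ≡⟨ cong (x +_) 2≡0 ⟩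
      x + 0#        ≡⟨ +-identityʳ x ⟩
      x             ∎
    +1-fixedPointFree : ∀ x → x + 1# ≢ x
    +1-fixedPointFree x x+1≡x = 1≢0 (+-cancelˡ x 1# 0# (trans x+1≡x (sym (+-identityʳ x))))

module Conics (F : Field) where
  open Field F
  open IntegerCoefficients F
  open FieldProperties F
  open CommutativeRing commutativeRing using (ring; +-comm; *-identityˡ; *-identityʳ; zeroʳ)
  open import Algebra.Properties.Ring ring using (+-inverseˡ-unique; +-inverseʳ-unique)
  open ≡-Reasoning

  X∞ Y∞ : Triple F
  X∞ = 1# , 0# , 0#
  Y∞ = 0# , 1# , 0#

  swapT : Triple F → Triple F
  swapT (x , y , z) = y , x , z

  swapQ : QForm F → QForm F
  swapQ (a , b , c , d , e , f) = b , a , c , d , f , e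

  evalQ-swap : ∀ Q v → evalQ F (swapQ Q) (swapT v) ≡ evalQ F Q v
  evalQ-swap (a , b , c , d , e , f) (x , y , z) = solve 9 (λ a b c d e f x y z →
    b :* y :* y :+ a :* x :* x :+ c :* z :* z :+ d :* y :* x :+ f :* y :* z :+ e :* x :* z
    := a :* x :* x :+ b :* y :* y :+ c :* z :* z :+ d :* x :* y :+ e :* x :* z :+ f :* y :* z) refl a b c d e f x y z

  evalQ-X∞ : ∀ {a b c d e f} → evalQ F (a , b , c , d , e , f) X∞ ≡ a
  evalQ-X∞ {a} {b} {c} {d} {e} {f} = solve 6 (λ a b c d e f →
    a :* κ 1 :* κ 1 :+ b :* κ 0 :* κ 0 :+ c :* κ 0 :* κ 0 :+ d :* κ 1 :* κ 0 :+ e :* κ 1 :* κ 0 :+ f :* κ 0 :* κ 0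
    := a) refl a b c d e f

  evalQ-Y∞ : ∀ {a b c d e f} → evalQ F (a , b , c , d , e , f) Y∞ ≡ b
  evalQ-Y∞ {a} {b} {c} {d} {e} {f} = trans (evalQ-swap (b , a , c , d , f , e) X∞) evalQ-X∞

  Splits : QForm F → Set
  Splits Q = Σ (Triple F) λ l → Σ (Triple F) λ m → Q ≡ linProd F l m

  irreducible⇒¬splits : ∀ {Q} → Irreducible F Q → ¬ Splits Q
  irreducible⇒¬splits (_ , notProduct) (l , m , Q≡lm) = notProduct l m Q≡lm

  swapQ-linProd : ∀ l m → swapQ (linProd F l m) ≡ linProd F (swapT l) (swapT m)
  swapQ-linProd (l₁ , l₂ , l₃) (m₁ , m₂ , m₃) =
    cong (λ t → l₂ * m₂ , l₁ * m₁ , l₃ * m₃ , t , l₂ * m₃ + l₃ * m₂ , l₁ * m₃ + l₃ * m₁) (+-comm (l₁ * m₂) (l₂ * m₁))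

  splits-swapQ : ∀ {Q} → Splits (swapQ Q) → Splits Q
  splits-swapQ {_ , _ , _ , _ , _ , _} (l , m , swapQ≡lm) =
    swapT l , swapT m , trans (cong swapQ swapQ≡lm) (swapQ-linProd l m)

  -- 4b·Q = (dX + 2bY + fZ)²
  zeroDiscriminant⇒splits : ∀ {a b c d e f} → two ≢ 0# → b ≢ 0# →
    d * d ≡ two * two * b * a × two * d * f ≡ two * two * b * e × f * f ≡ two * two * b * c →
    Splits (a , b , c , d , e , f)
  zeroDiscriminant⇒splits {a} {b} {c} {d} {e} {f} 2≢0 b≢0 (dd≡4ba , 2df≡4be , ff≡4bc) =
    (d , two * b , f) , (k * d , k * (two * b) , k * f) ,
    cong₂ _,_ a≡ (cong₂ _,_ b≡ (cong₂ _,_ c≡ (cong₂ _,_ d≡ (cong₂ _,_ e≡ f≡))))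
    where
    4b k : Carrier
    4b = two * two * b
    k = 4b ⁻¹
    divide : ∀ {z w} → 4b * z ≡ w → z ≡ k * w
    divide {z} 4bz≡w =
      trans (sym (⁻¹-cancelˡ (x≢0∧y≢0⇒x*y≢0 (x≢0∧y≢0⇒x*y≢0 2≢0 2≢0) b≢0) z)) (cong (k *_) 4bz≡w)
    a≡ : a ≡ d * (k * d)
    a≡ = trans (divide (sym dd≡4ba)) (solve 2 (λ k d → k :* (d :* d) := d :* (k :* d)) refl k d)
    b≡ : b ≡ two * b * (k * (two * b))
    b≡ = trans (divide (solve 1 (λ b → κ 2 :* κ 2 :* b :* b := (κ 2 :* b) :* (κ 2 :* b)) refl b))
               (solve 2 (λ k t → k :* (t :* t) := t :* (k :* t)) refl k (two * b))
    c≡ : c ≡ f * (k * f)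
    c≡ = trans (divide (sym ff≡4bc)) (solve 2 (λ k f → k :* (f :* f) := f :* (k :* f)) refl k f)
    d≡ : d ≡ d * (k * (two * b)) + two * b * (k * d)
    d≡ = trans (divide refl) (solve 3 (λ k b d →
      k :* (κ 2 :* κ 2 :* b :* d) := d :* (k :* (κ 2 :* b)) :+ κ 2 :* b :* (k :* d)) refl k b d)
    e≡ : e ≡ d * (k * f) + f * (k * d)
    e≡ = trans (divide (sym 2df≡4be)) (solve 3 (λ k d f →
      k :* (κ 2 :* d :* f) := d :* (k :* f) :+ f :* (k :* d)) refl k d f)
    f≡ : f ≡ two * b * (k * f) + f * (k * (two * b))
    f≡ = trans (divide refl) (solve 3 (λ k b f →
      k :* (κ 2 :* κ 2 :* b :* f) := κ 2 :* b :* (k :* f) :+ f :* (k :* (κ 2 :* b))) refl k b f)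

  AffineGraph : QForm F → (Carrier → Carrier) → Set
  AffineGraph Q φ = ∀ x y → OnConic F Q (x , y , 1#) ⇔ y ≡ φ x

  affineGraph⇒splits : ∀ {Q φ} → two ≢ 0# → ¬ OnConic F Q Y∞ → AffineGraph Q φ → Splits Q
  affineGraph⇒splits {Q@(a , b , c , d , e , f)} {φ} 2≢0 Y∞∉C graph =
    zeroDiscriminant⇒splits 2≢0 b≢0 (quadratic-injective 2≢0 discriminant≡0)
    where
    b≢0 : b ≢ 0#
    b≢0 b≡0 = Y∞∉C (trans evalQ-Y∞ b≡0)
    onAffineChart : ∀ x y → evalQ F Q (x , y , 1#) ≡ quadratic b (d * x + f) (a * x * x + e * x + c) y
    onAffineChart = solve 8 (λ a b c d e f x y →
      a :* x :* x :+ b :* y :* y :+ c :* κ 1 :* κ 1 :+ d :* x :* y :+ e :* x :* κ 1 :+ f :* y :* κ 1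
      := b :* y :* y :+ (d :* x :+ f) :* y :+ (a :* x :* x :+ e :* x :+ c)) refl a b c d e f
    discriminant≡0 : ∀ x → quadratic (d * d) (two * d * f) (f * f) x ≡
      quadratic (two * two * b * a) (two * two * b * e) (two * two * b * c) x
    discriminant≡0 x = begin
      quadratic (d * d) (two * d * f) (f * f) x
        ≡⟨ solve 3 (λ d f x → d :* d :* x :* x :+ κ 2 :* d :* f :* x :+ f :* f := (d :* x :+ f) :* (d :* x :+ f))
                   refl d f x ⟩
      (d * x + f) * (d * x + f)
        ≡⟨ doubleRoot⇒discriminant≡0 root (uniqueRoot⇒doubleRoot b≢0 root unique) ⟩
      two * two * b * (a * x * x + e * x + c)
        ≡⟨ solve 5 (λ a b c e x →
             κ 2 :* κ 2 :* b :* (a :* x :* x :+ e :* x :+ c)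
             := κ 2 :* κ 2 :* b :* a :* x :* x :+ κ 2 :* κ 2 :* b :* e :* x :+ κ 2 :* κ 2 :* b :* c) refl a b c e x ⟩
      quadratic (two * two * b * a) (two * two * b * e) (two * two * b * c) x
        ∎
      where
      root : quadratic b (d * x + f) (a * x * x + e * x + c) (φ x) ≡ 0#
      root = trans (sym (onAffineChart x (φ x))) (Equivalence.from (graph x (φ x)) refl)
      unique : ∀ y → quadratic b (d * x + f) (a * x * x + e * x + c) y ≡ 0# → y ≡ φ x
      unique y y-root = Equivalence.to (graph x y) (trans (onAffineChart x y) y-root)

  affineGraph-swapQ : ∀ {Q σ} → IsPermutation F σ → AffineGraph Q σ →
    Σ (Carrier → Carrier) (AffineGraph (swapQ Q))
  affineGraph-swapQ {Q} {σ} σ-bijective graph = from , λ y x → mk⇔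
    (λ onC → sym (inverseʳ (Equivalence.to (graph x y) (trans (sym (evalQ-swap Q (x , y , 1#))) onC))))
    (λ x≡σ⁻¹y → trans (evalQ-swap Q (x , y , 1#)) (Equivalence.from (graph x y) (sym (inverseˡ x≡σ⁻¹y))))
    where open Inverse (⤖⇒↔ (mk⤖ σ-bijective))

  ∼-refl : ∀ {v} → _∼_ F v v
  ∼-refl {x , y , z} = 1# , 1≢0 , sym (*-identityˡ x) , sym (*-identityˡ y) , sym (*-identityˡ z)

  OnConic-resp-∼ : ∀ Q {v w} → _∼_ F v w → OnConic F Q v → OnConic F Q w
  OnConic-resp-∼ (a , b , c , d , e , f) {w = X , Y , Z} (t , t≢0 , refl , refl , refl) v∈C =
    x*y≡0⇒y≡0 t≢0 (x*y≡0⇒y≡0 t≢0 (trans (sym (scale a b c d e f t X Y Z)) v∈C))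
    where
    scale : ∀ a b c d e f t X Y Z →
      a * (t * X) * (t * X) + b * (t * Y) * (t * Y) + c * (t * Z) * (t * Z)
        + d * (t * X) * (t * Y) + e * (t * X) * (t * Z) + f * (t * Y) * (t * Z)
      ≡ t * (t * (a * X * X + b * Y * Y + c * Z * Z + d * X * Y + e * X * Z + f * Y * Z))
    scale = solve 10 (λ a b c d e f t X Y Z →
      a :* (t :* X) :* (t :* X) :+ b :* (t :* Y) :* (t :* Y) :+ c :* (t :* Z) :* (t :* Z)
        :+ d :* (t :* X) :* (t :* Y) :+ e :* (t :* X) :* (t :* Z) :+ f :* (t :* Y) :* (t :* Z)
      := t :* (t :* (a :* X :* X :+ b :* Y :* Y :+ c :* Z :* Z :+ d :* X :* Y :+ e :* X :* Z :+ f :* Y :* Z))) refl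

  ∼-atInfinity : ∀ {u v p₁ p₂ p₃} → _∼_ F (u , v , 0#) (p₁ , p₂ , p₃) → p₃ ≡ 0#
  ∼-atInfinity (t , t≢0 , _ , _ , 0≡tp₃) = x*y≡0⇒y≡0 t≢0 (sym 0≡tp₃)

  affine≁atInfinity : ∀ {x y u v} → ¬ _∼_ F (x , y , 1#) (u , v , 0#)
  affine≁atInfinity (t , _ , _ , _ , 1≡t0) = 1≢0 (trans 1≡t0 (zeroʳ t))

  ∼-affine : ∀ {x y x′ y′} → _∼_ F (x , y , 1#) (x′ , y′ , 1#) → x ≡ x′ × y ≡ y′
  ∼-affine {x′ = x′} {y′} (t , _ , x≡tx′ , y≡ty′ , 1≡t1) =
    trans x≡tx′ (trans (cong (_* x′) t≡1) (*-identityˡ x′)) ,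
    trans y≡ty′ (trans (cong (_* y′) t≡1) (*-identityˡ y′))
    where
    t≡1 : t ≡ 1#
    t≡1 = trans (sym (*-identityʳ t)) (sym 1≡t1)

  affine-nonZero : ∀ {x y} → NonZeroTriple F (x , y , 1#)
  affine-nonZero (_ , _ , 1≡0) = 1≢0 1≡0

  X∞-nonZero : NonZeroTriple F X∞
  X∞-nonZero (1≡0 , _ , _) = 1≢0 1≡0

  Y∞-nonZero : NonZeroTriple F Y∞
  Y∞-nonZero (_ , 1≡0 , _) = 1≢0 1≡0

  InΩ-affine : ∀ {σ x y} → InΩ F σ (x , y , 1#) ⇔ y ≡ σ x
  InΩ-affine {σ} {x} {y} = mk⇔ to from
    where
    to : InΩ F σ (x , y , 1#) → y ≡ σ x
    to (inj₁ (x′ , v∼graph)) with ∼-affine v∼graph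
    ... | x≡x′ , y≡σx′ = trans y≡σx′ (cong σ (sym x≡x′))
    to (inj₂ (inj₁ v∼X∞)) = ⊥-elim (affine≁atInfinity v∼X∞)
    to (inj₂ (inj₂ v∼Y∞)) = ⊥-elim (affine≁atInfinity v∼Y∞)
    from : y ≡ σ x → InΩ F σ (x , y , 1#)
    from refl = inj₁ (x , ∼-refl)

  ConicPlusPoint : (Carrier → Carrier) → QForm F → Triple F → Set
  ConicPlusPoint σ Q P = ∀ v → NonZeroTriple F v → InΩ F σ v ⇔ (OnConic F Q v ⊎ _∼_ F v P)

  atInfinity∼P⇒affineGraph : ∀ {σ Q P u v} → ConicPlusPoint σ Q P → _∼_ F (u , v , 0#) P → AffineGraph Q σ
  atInfinity∼P⇒affineGraph {σ} {Q} {P@(p₁ , p₂ , p₃)} Ω≡C∪P ∞∼P x y = mk⇔ to from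
    where
    Ω : InΩ F σ (x , y , 1#) ⇔ (OnConic F Q (x , y , 1#) ⊎ _∼_ F (x , y , 1#) P)
    Ω = Ω≡C∪P (x , y , 1#) affine-nonZero
    to : OnConic F Q (x , y , 1#) → y ≡ σ x
    to onC = Equivalence.to InΩ-affine (Equivalence.from Ω (inj₁ onC))
    from : y ≡ σ x → OnConic F Q (x , y , 1#)
    from y≡σx with Equivalence.to Ω (Equivalence.from InΩ-affine y≡σx)
    ... | inj₁ onC = onC
    ... | inj₂ v∼P = ⊥-elim (affine≁atInfinity
      (subst (λ z → _∼_ F (x , y , 1#) (p₁ , p₂ , z)) (∼-atInfinity ∞∼P) v∼P))

  FractionalLinearGraph : QForm F → Set
  FractionalLinearGraph Q = Σ Carrier λ c → Σ Carrier λ d → Σ Carrier λ e → Σ Carrier λ f →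
    ∀ x y → OnConic F Q (x , y , 1#) ⇔ (c * x + e ≢ 0# × y ≡ (d * x + f) * ((c * x + e) ⁻¹))

  -- (dY + eZ)(X - xZ)
  verticalLine⇒splits : ∀ {c d e f} x → d * x + f ≡ 0# → e * x + c ≡ 0# → Splits (0# , 0# , c , d , e , f)
  verticalLine⇒splits {c} {d} {e} {f} x dx+f≡0 ex+c≡0 = (0# , d , e) , (1# , 0# , - x) ,
    cong₂ _,_ (solve 0 (κ 0 := κ 0 :* κ 1) refl) (cong₂ _,_ (solve 1 (λ d → κ 0 := d :* κ 0) refl d)
      (cong₂ _,_ c≡ (cong₂ _,_ (solve 1 (λ d → d := κ 0 :* κ 0 :+ d :* κ 1) refl d)
        (cong₂ _,_ (solve 2 (λ e x → e := κ 0 :* :- x :+ e :* κ 1) refl e x) f≡))))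
    where
    c≡ : c ≡ e * - x
    c≡ = trans (+-inverseʳ-unique (e * x) c ex+c≡0) (solve 2 (λ e x → :- (e :* x) := e :* :- x) refl e x)
    f≡ : f ≡ d * - x + e * 0#
    f≡ = trans (+-inverseʳ-unique (d * x) f dx+f≡0)
      (solve 3 (λ d e x → :- (d :* x) := d :* :- x :+ e :* κ 0) refl d e x)

  hyperbola⇒fractionalLinear : ∀ {c d e f} → Irreducible F (0# , 0# , c , d , e , f) →
    FractionalLinearGraph (0# , 0# , c , d , e , f)
  hyperbola⇒fractionalLinear {c} {d} {e} {f} irreducible = d , - e , f , - c , λ x y → mk⇔ (to x y) (from x y)
    where
    onAffineChart : ∀ x y → evalQ F (0# , 0# , c , d , e , f) (x , y , 1#) ≡ y * (d * x + f) + (e * x + c)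
    onAffineChart x y = solve 6 (λ c d e f x y →
      κ 0 :* x :* x :+ κ 0 :* y :* y :+ c :* κ 1 :* κ 1 :+ d :* x :* y :+ e :* x :* κ 1 :+ f :* y :* κ 1
      := y :* (d :* x :+ f) :+ (e :* x :+ c)) refl c d e f x y
    to : ∀ x y → OnConic F (0# , 0# , c , d , e , f) (x , y , 1#) →
      d * x + f ≢ 0# × y ≡ (- e * x + - c) * ((d * x + f) ⁻¹)
    to x y onC = W≢0 , Equivalence.to (x*y≡z⇔x≡z*y⁻¹ W≢0) yW≡V
      where
      yW+U≡0 : y * (d * x + f) + (e * x + c) ≡ 0#
      yW+U≡0 = trans (sym (onAffineChart x y)) onC
      yW≡V : y * (d * x + f) ≡ - e * x + - c
      yW≡V = trans (+-inverseˡ-unique _ _ yW+U≡0)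
        (solve 3 (λ c e x → :- (e :* x :+ c) := :- e :* x :+ :- c) refl c e x)
      W≢0 : d * x + f ≢ 0#
      W≢0 W≡0 = irreducible⇒¬splits irreducible (verticalLine⇒splits x W≡0 (begin
        e * x + c                      ≡⟨ solve 2 (λ u y → u := y :* κ 0 :+ u) refl (e * x + c) y ⟩
        y * 0# + (e * x + c)           ≡⟨ cong (λ w → y * w + (e * x + c)) (sym W≡0) ⟩
        y * (d * x + f) + (e * x + c)  ≡⟨ yW+U≡0 ⟩
        0#                             ∎))
    from : ∀ x y → d * x + f ≢ 0# × y ≡ (- e * x + - c) * ((d * x + f) ⁻¹) →
      OnConic F (0# , 0# , c , d , e , f) (x , y , 1#)
    from x y (W≢0 , y≡V/W) = begin
      evalQ F (0# , 0# , c , d , e , f) (x , y , 1#)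
        ≡⟨ onAffineChart x y ⟩
      y * (d * x + f) + (e * x + c)
        ≡⟨ cong (_+ (e * x + c)) (Equivalence.from (x*y≡z⇔x≡z*y⁻¹ W≢0) y≡V/W) ⟩
      (- e * x + - c) + (e * x + c)
        ≡⟨ solve 3 (λ c e x → (:- e :* x :+ :- c) :+ (e :* x :+ c) := κ 0) refl c e x ⟩
      0#
        ∎

  axisPoints∈C⇒fractionalLinear : ∀ {Q} → Irreducible F Q → OnConic F Q X∞ → OnConic F Q Y∞ →
    FractionalLinearGraph Q
  axisPoints∈C⇒fractionalLinear {a , b , c , d , e , f} irreducible X∞∈C Y∞∈C =
    subst₂ (λ a b → Irreducible F (a , b , c , d , e , f) → FractionalLinearGraph (a , b , c , d , e , f))
      (sym (trans (sym evalQ-X∞) X∞∈C)) (sym (trans (sym evalQ-Y∞) Y∞∈C)) hyperbola⇒fractionalLinear irreducible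

  conicPlusPoint⇒fractionalLinear : ∀ {σ Q P} → two ≢ 0# → IsPermutation F σ → Irreducible F Q →
    ¬ OnConic F Q P → ConicPlusPoint σ Q P → FractionalLinearGraph Q
  conicPlusPoint⇒fractionalLinear {σ} {Q} {P} 2≢0 σ-bijective irreducible P∉C Ω≡C∪P
    with Equivalence.to (Ω≡C∪P X∞ X∞-nonZero) (inj₂ (inj₁ ∼-refl))
       | Equivalence.to (Ω≡C∪P Y∞ Y∞-nonZero) (inj₂ (inj₂ ∼-refl))
  ... | inj₁ X∞∈C | inj₁ Y∞∈C = axisPoints∈C⇒fractionalLinear irreducible X∞∈C Y∞∈C
  ... | inj₂ X∞∼P | _ = ⊥-elim (irreducible⇒¬splits irreducible
        (splits-swapQ (affineGraph⇒splits 2≢0 Y∞∉swapC (proj₂ (affineGraph-swapQ σ-bijective graph)))))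
    where
    graph : AffineGraph Q σ
    graph = atInfinity∼P⇒affineGraph Ω≡C∪P X∞∼P
    Y∞∉swapC : ¬ OnConic F (swapQ Q) Y∞
    Y∞∉swapC Y∞∈swapC = P∉C (OnConic-resp-∼ Q X∞∼P (trans (sym (evalQ-swap Q X∞)) Y∞∈swapC))
  ... | inj₁ _ | inj₂ Y∞∼P = ⊥-elim (irreducible⇒¬splits irreducible
        (affineGraph⇒splits 2≢0 (λ Y∞∈C → P∉C (OnConic-resp-∼ Q Y∞∼P Y∞∈C)) (atInfinity∼P⇒affineGraph Ω≡C∪P Y∞∼P)))

-- The count of collinear triples is what makes Ω a conic plus a point, and that is assumed here.
mainTheorem5 : (F : Field) → let open Field F in
    (q : ℕ) → OddPrimePower q → (enum : HasSize F q) →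
    (σ : Carrier → Carrier) → IsPermutation F σ →
    ExactlyNCollinearTriples F q enum σ ((q ∸ 1) / 2) →
    (Q : QForm F) → Irreducible F Q →
    (P : Triple F) → NonZeroTriple F P → ¬ OnConic F Q P →
    (∀ v → NonZeroTriple F v → InΩ F σ v ⇔ (OnConic F Q v ⊎ _∼_ F v P)) →
    Σ Carrier λ c → Σ Carrier λ d → Σ Carrier λ e → Σ Carrier λ f →
    ∀ x y → OnConic F Q (x , y , 1#) ⇔
    (c * x + e ≢ 0# × y ≡ (d * x + f) * ((c * x + e) ⁻¹))
mainTheorem5 F q (_ , 2∤q) enum σ σ-bijective _ Q irreducible P _ P∉C Ω≡C∪P =
  conicPlusPoint⇒fractionalLinear (oddSize⇒2≢0 enum 2∤q) σ-bijective irreducible P∉C Ω≡C∪P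
  where
  open FieldProperties F
  open Conics F
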